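{- Let $\overrightarrow{G}$ be a digraph of order $n$ with no weakly connected components of order less than $4$. Then $\overrightarrow{G}$ has a $\Gamma$-irregular labeling for every finite Abelian group $\Gamma$ such that $|\Gamma|\geq 2n+1$.
   Context: Digraphs are finite; the order of a digraph is its number of vertices. For a digraph $\overrightarrow{G}=(V,A)$, its underlying graph has vertex set $V$ and an edge $\{x,y\}$ whenever $(x,y)\in A$ or $(y,x)\in A$; a weakly connected component of $\overrightarrow{G}$ is the subdigraph induced by the vertex set of a connected component of the underlying graph. For a finite Abelian group $\Gamma$ (written additively), a labeling $\psi\colon A\to\Gamma$ is a $\Gamma$-irregular labeling of $\overrightarrow{G}$ if the map $\varphi_\psi\colon V\to\Gamma$, $\varphi_\psi(x)=\sum_{y\colon (y,x)\in A}\psi((y,x))-\sum_{y\colon (x,y)\in A}\psi((x,y))$, is injective. -}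

module Defs where

open import Level using (Level)
open import Data.Nat using (ℕ; zero; suc)
open import Data.Fin using (Fin; zero; suc)
open import Data.Bool using (Bool; true; false)
open import Data.Product using (Σ; ∃; _×_; _,_)
open import Data.Sum using (_⊎_)
open import Relation.Binary.PropositionalEquality using (_≡_; refl)
open import Algebra.Bundles using (AbelianGroup)

record Digraph (n : ℕ) : Set where
  field
    arc : Fin n → Fin n → Bool
open Digraph public

Labeling : ∀ {c} {n : ℕ} → Digraph n → Set c → Set c
Labeling {n = n} G C = (x y : Fin n) → arc G x y ≡ true → C

module _ {c ℓ} (Γ : AbelianGroup c ℓ) where
  open AbelianGroup Γ using (Carrier; _≈_; _∙_; ε; _-_)

  ifArc : (b : Bool) → (b ≡ true → Carrier) → Carrier
  ifArc true  f = f refl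
  ifArc false f = ε

  ΣFin : (n : ℕ) → (Fin n → Carrier) → Carrier
  ΣFin zero    f = ε
  ΣFin (suc n) f = f zero ∙ ΣFin n (λ i → f (suc i))

  φ : {n : ℕ} (G : Digraph n) → Labeling G Carrier → Fin n → Carrier
  φ {n} G ψ x =
    ΣFin n (λ y → ifArc (arc G y x) (ψ y x))
      - ΣFin n (λ y → ifArc (arc G x y) (ψ x y))

  IsIrregular : {n : ℕ} (G : Digraph n) → Labeling G Carrier → Set ℓ
  IsIrregular {n} G ψ = ∀ x y → φ G ψ x ≈ φ G ψ y → x ≡ y

  HasOrder : ℕ → Set (c Level.⊔ ℓ)
  HasOrder m = Σ (Fin m → Carrier) λ e →
    (∀ i j → e i ≈ e j → i ≡ j) × (∀ g → ∃ λ i → e i ≈ g)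

Adj : {n : ℕ} → Digraph n → Fin n → Fin n → Set
Adj G x y = (arc G x y ≡ true) ⊎ (arc G y x ≡ true)

data Conn {n : ℕ} (G : Digraph n) (x : Fin n) : Fin n → Set where
  here : Conn G x x
  step : ∀ {y z} → Conn G x y → Adj G y z → Conn G x z

NoSmallComponents : {n : ℕ} → Digraph n → Set
NoSmallComponents {n} G = ∀ x → Σ (Fin 4 → Fin n) λ f →
  (∀ i j → f i ≡ f j → i ≡ j) × (∀ i → Conn G x (f i))

{-# OPTIONS --safe #-}
module Submission where

-- Call a vertex separated by ψ if its φ_ψ-value differs from that of every
-- other vertex; starting from the zero labeling we separate the vertices one
-- at a time. To separate x, take two more vertices y, z of its weak component
-- and transfer amounts g, h from x to y and to z along walks (with g⁻¹, h⁻¹ on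
-- arcs traversed backwards). This changes φ only at x, y, z, namely to
-- φ x − g − h, φ y + g and φ z + h, so vertices separated before stay
-- separated as long as the three new values are pairwise distinct and avoid
-- the values of the other vertices. Prescribing the new values a of y and b of
-- z makes the value at x equal to c − a − b for a fixed c, and a double count
-- shows that |Γ| ≥ 2n leaves room for a suitable choice of a and b.

open import Defs
open import Level using (_⊔_)
open import Algebra.Bundles using (AbelianGroup)
open import Data.Bool using (Bool; true; false; if_then_else_)
open import Data.Fin using (Fin; zero; suc; _≟_; toℕ; fromℕ<; punchIn)
open import Data.Fin.Patterns using (0F; 1F; 2F)
open import Data.Fin.Properties as Finₚ
  using (any?; ¬∀⟶∃¬; punchInᵢ≢i; toℕ-injective; toℕ-fromℕ<; toℕ<n)
open import Data.Nat using (ℕ; zero; suc; _+_; _*_; _≤_; _<_; z≤n; s≤s; s≤s⁻¹; z<s)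
open import Data.Nat.Properties
  using ( ≤-refl; ≤-reflexive; ≤-trans; ≤-<-trans; <-≤-trans; <-irrefl; <⇒≤; ≮⇒≥; _<?_
        ; +-mono-≤; +-monoˡ-≤; +-mono-≤-<; +-monoˡ-<; +-cancelˡ-<; *-monoʳ-≤
        ; m≤m+n; m≤n+m; m<m+n; m<1+n⇒m<n∨m≡n; +-0-commutativeMonoid; module ≤-Reasoning)
open import Data.Product using (Σ; ∃; ∃₂; _×_; _,_; proj₁; proj₂; map; map₂)
open import Data.Sum using (_⊎_; inj₁; inj₂)
open import Function using (_∘_; id)
open import Function.Definitions using (Injective)
import Relation.Binary.PropositionalEquality as ≡
open ≡ using (_≡_; _≢_)
open import Relation.Nullary using (Dec; does; yes; no; ¬_; contradiction)
open import Relation.Nullary.Decidable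
  using (dec-true; dec-false; _×-dec_; _⊎-dec_; toSum; decidable-stable)
open import Relation.Unary using (Pred; Decidable; _⊆_; ∁)
open import Relation.Unary.Properties using (_∪?_; ∁?; U?)
open import Algebra.Properties.CommutativeMonoid.Sum +-0-commutativeMonoid
  using (sum; ∑-comm; ∑-distrib-+)

indicator : ∀ {a} {A : Set a} → Dec A → ℕ
indicator a? = if does a? then 1 else 0

count : ∀ {k p} {P : Pred (Fin k) p} → Decidable P → ℕ
count P? = sum (indicator ∘ P?)

module _ {a b} {A : Set a} {B : Set b} where

  indicator-mono : (A → B) → (a? : Dec A) (b? : Dec B) → indicator a? ≤ indicator b?
  indicator-mono A→B a? b? with a? | b?
  ... | no _  | _     = z≤n
  ... | yes _ | yes _ = ≤-refl
  ... | yes a | no ¬b = contradiction (A→B a) ¬b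

  indicator-⊎ : (a? : Dec A) (b? : Dec B) → indicator (a? ⊎-dec b?) ≤ indicator a? + indicator b?
  indicator-⊎ a? b? with does a?
  ... | true  = s≤s z≤n
  ... | false = ≤-refl

sum-mono-≤ : ∀ {k} {f g : Fin k → ℕ} → (∀ i → f i ≤ g i) → sum f ≤ sum g
sum-mono-≤ {zero}  f≤g = z≤n
sum-mono-≤ {suc k} f≤g = +-mono-≤ (f≤g zero) (sum-mono-≤ (f≤g ∘ suc))

module _ {k p q} {P : Pred (Fin k) p} {Q : Pred (Fin k) q} where

  count-mono : P ⊆ Q → (P? : Decidable P) (Q? : Decidable Q) → count P? ≤ count Q?
  count-mono P⊆Q P? Q? = sum-mono-≤ (λ i → indicator-mono P⊆Q (P? i) (Q? i))

  count-∪ : (P? : Decidable P) (Q? : Decidable Q) → ∀ {a b} →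
            count P? ≤ a → count Q? ≤ b → count (P? ∪? Q?) ≤ a + b
  count-∪ P? Q? {a} {b} #P≤a #Q≤b = begin
    count (P? ∪? Q?)
      ≤⟨ sum-mono-≤ (λ i → indicator-⊎ (P? i) (Q? i)) ⟩
    sum (λ i → indicator (P? i) + indicator (Q? i))
      ≡⟨ ∑-distrib-+ (indicator ∘ P?) (indicator ∘ Q?) ⟩
    count P? + count Q?
      ≤⟨ +-mono-≤ #P≤a #Q≤b ⟩
    a + b ∎
    where open ≤-Reasoning

count-< : ∀ {k p q} {P : Pred (Fin k) p} {Q : Pred (Fin k) q} → P ⊆ Q →
          (P? : Decidable P) (Q? : Decidable Q) → ∀ {i} → Q i → ¬ P i → count P? < count Q?
count-< {suc k} P⊆Q P? Q? {zero} qi ¬pi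
  rewrite dec-false (P? zero) ¬pi | dec-true (Q? zero) qi =
  s≤s (count-mono P⊆Q (P? ∘ suc) (Q? ∘ suc))
count-< {suc k} P⊆Q P? Q? {suc i} qi ¬pi =
  +-mono-≤-< (indicator-mono P⊆Q (P? zero) (Q? zero)) (count-< P⊆Q (P? ∘ suc) (Q? ∘ suc) qi ¬pi)

count-empty : ∀ {k p} {P : Pred (Fin k) p} (P? : Decidable P) → (∀ i → ¬ P i) → count P? ≡ 0
count-empty {zero}  P? ∅ = ≡.refl
count-empty {suc k} P? ∅ rewrite dec-false (P? zero) (∅ zero) = count-empty (P? ∘ suc) (∅ ∘ suc)

count-universal : ∀ {k p} {P : Pred (Fin k) p} (P? : Decidable P) → (∀ i → P i) → count P? ≡ k
count-universal {zero}  P? all = ≡.refl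
count-universal {suc k} P? all rewrite dec-true (P? zero) (all zero) =
  ≡.cong suc (count-universal (P? ∘ suc) (all ∘ suc))

count-≤1 : ∀ {k p} {P : Pred (Fin k) p} (P? : Decidable P) →
           (∀ i j → P i → P j → i ≡ j) → count P? ≤ 1
count-≤1 {zero}  P? unique = z≤n
count-≤1 {suc k} P? unique with P? zero
... | yes p = ≤-reflexive (≡.cong suc (count-empty (P? ∘ suc)
                λ i pi → Finₚ.0≢1+n (unique zero (suc i) p pi)))
... | no _  = count-≤1 (P? ∘ suc) λ i j pi pj → Finₚ.suc-injective (unique (suc i) (suc j) pi pj)

2+count∁≤ : ∀ {k p} {P : Pred (Fin k) p} (P? : Decidable P) {x y} → P x → P y → x ≢ y →
            2 + count (∁? P?) ≤ k
2+count∁≤ {k} {P = P} P? {x} {y} px py x≢y = begin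
  2 + count (∁? P?)
    ≤⟨ s≤s (count-< (λ ¬p v≡x → ¬p (≡.subst P (≡.sym v≡x) px))
                    (∁? P?) (∁? (_≟ x)) (x≢y ∘ ≡.sym) (λ ¬p → ¬p py)) ⟩
  1 + count (∁? (_≟ x))
    ≤⟨ count-< (λ _ → _) (∁? (_≟ x)) U? _ (λ x≢x → x≢x ≡.refl) ⟩
  count {k} U?
    ≡⟨ count-universal U? _ ⟩
  k ∎
  where open ≤-Reasoning

count<k⇒∃¬ : ∀ {k p} {P : Pred (Fin k) p} (P? : Decidable P) → count P? < k → ∃ λ i → ¬ P i
count<k⇒∃¬ {k} {P = P} P? count<k =
  ¬∀⟶∃¬ k P P? (λ all → <-irrefl (count-universal P? all) count<k)

∃-below-average : ∀ {k p} {P : Pred (Fin k) p} (P? : Decidable P) (f : Fin k → ℕ) c →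
                  sum f < count P? * c → ∃ λ i → P i × f i < c
∃-below-average {suc k} P? f c ∑f< with P? zero | f zero <? c
... | yes p | yes f₀<c = zero , p , f₀<c
... | yes p | no  f₀≮c = map suc id (∃-below-average (P? ∘ suc) (f ∘ suc) c
  (+-cancelˡ-< c _ _ (≤-<-trans (+-monoˡ-≤ _ (≮⇒≥ f₀≮c)) ∑f<)))
... | no ¬p | _        = map suc id (∃-below-average (P? ∘ suc) (f ∘ suc) c
  (≤-<-trans (m≤n+m _ (f zero)) ∑f<))

∑-count-≤ : ∀ {k l r} {R : Fin k → Pred (Fin l) r} (R? : ∀ i → Decidable (R i)) →
            (∀ j i i′ → R i j → R i′ j → i ≡ i′) → sum (λ i → count (R? i)) ≤ l
∑-count-≤ {k} {l} R? columns = begin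
  sum (λ i → count (R? i))          ≡⟨ ∑-comm (λ i j → indicator (R? i j)) ⟩
  sum (λ j → count (λ i → R? i j))  ≤⟨ sum-mono-≤ (λ j → count-≤1 (λ i → R? i j) (columns j)) ⟩
  count {l} U?                      ≡⟨ count-universal U? _ ⟩
  l                                 ∎
  where open ≤-Reasoning

Image : ∀ {n m p} → Pred (Fin n) p → (Fin n → Fin m) → Pred (Fin m) p
Image O σ t = ∃ λ v → O v × σ v ≡ t

Image? : ∀ {n m p} {O : Pred (Fin n) p} → Decidable O → (σ : Fin n → Fin m) →
         Decidable (Image O σ)
Image? O? σ t = any? (λ v → O? v ×-dec σ v ≟ t)

count-Image∘inj : ∀ {n m k p} {O : Pred (Fin n) p} (O? : Decidable O) (σ : Fin n → Fin m)
                  {F : Fin k → Fin m} → Injective _≡_ _≡_ F → count (Image? O? σ ∘ F) ≤ count O?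
count-Image∘inj {zero} O? σ {F} F-inj =
  ≤-reflexive (count-empty (Image? O? σ ∘ F) λ { _ (() , _) })
count-Image∘inj {suc n} {O = O} O? σ {F} F-inj =
  count-∪ (hit₀ (O? zero)) (Image? (O? ∘ suc) (σ ∘ suc) ∘ F)
          (hit₀-bound (O? zero)) (count-Image∘inj (O? ∘ suc) (σ ∘ suc) F-inj)
  where
  hit₀ : Dec (O zero) → Decidable (λ t → O zero × σ zero ≡ F t)
  hit₀ o? t = o? ×-dec σ zero ≟ F t

  hit₀-bound : (o? : Dec (O zero)) → count (hit₀ o?) ≤ indicator o?
  hit₀-bound o?@(yes _) = count-≤1 (hit₀ o?) λ { _ _ (_ , e) (_ , e′) → F-inj (≡.trans (≡.sym e) e′) }
  hit₀-bound o?@(no ¬o) = ≤-reflexive (count-empty (hit₀ o?) λ { _ (o , _) → ¬o o })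

private
  module Arith where
    open import Data.Nat.Solver using (module +-*-Solver)
    open +-*-Solver
    open ≤-Reasoning

    m<g*2 : ∀ {m s g} → m ≤ s + g → 2 * s < m → m < g * 2
    m<g*2 {m} {s} {g} m≤s+g 2s<m = +-cancelˡ-< m m (g * 2) (begin-strict
      m + m              ≤⟨ +-mono-≤ m≤s+g m≤s+g ⟩
      (s + g) + (s + g)  ≡⟨ solve 2 (λ s g → (s :+ g) :+ (s :+ g) := con 2 :* s :+ g :* con 2)
                                  ≡.refl s g ⟩
      2 * s + g * 2      <⟨ +-monoˡ-< (g * 2) 2s<m ⟩
      m + g * 2          ∎)

    s+[s+3]<m : ∀ {m s} → 2 * s + 4 ≤ m → s + (s + (1 + (1 + 1))) < m
    s+[s+3]<m {m} {s} 2s+4≤m = begin-strict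
      s + (s + (1 + (1 + 1)))  <⟨ ≤-reflexive (solve 1 (λ s → con 1 :+ (s :+ (s :+ con 3))
                                                           := con 2 :* s :+ con 4) ≡.refl s) ⟩
      2 * s + 4                ≤⟨ 2s+4≤m ⟩
      m                        ∎

    2s+4≤m : ∀ {m n s} → 2 + s ≤ n → 2 * n ≤ m → 2 * s + 4 ≤ m
    2s+4≤m {m} {n} {s} 2+s≤n 2n≤m = begin
      2 * s + 4    ≡⟨ solve 1 (λ s → con 2 :* s :+ con 4 := con 2 :* (con 2 :+ s)) ≡.refl s ⟩
      2 * (2 + s)  ≤⟨ *-monoʳ-≤ 2 2+s≤n ⟩
      2 * n        ≤⟨ 2n≤m ⟩
      m            ∎

Fresh : ∀ {n m p} → Pred (Fin n) p → (Fin n → Fin m) → Pred (Fin m) p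
Fresh O σ = ∁ (Image O σ)

FreshTriple : ∀ {n m p} → Pred (Fin n) p → (Fin n → Fin m) → (Fin m → Fin m → Fin m) → Set p
FreshTriple O σ X =
  ∃₂ λ i j → Fresh O σ i × Fresh O σ j × Fresh O σ (X i j) × i ≢ j × X i j ≢ i × X i j ≢ j

-- Apart from X i j ≢ j, the conditions on j exclude at most 2s + 2 values. For
-- fixed i the equation X i j ≡ j may have many solutions j (in a group it reads
-- 2b = c − a), but for fixed j at most one solution i, so averaging over the
-- more than m/2 fresh values of i yields one with at most one such j.
fresh-triple : ∀ {n m p} {O : Pred (Fin n) p} (O? : Decidable O) (σ : Fin n → Fin m)
  (X : Fin m → Fin m → Fin m) →
  (∀ i → Injective _≡_ _≡_ (X i)) → (∀ j → Injective _≡_ _≡_ (λ i → X i j)) →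
  2 * count O? + 4 ≤ m → FreshTriple O σ X
fresh-triple {n} {m} {O = O} O? σ X X-injʳ X-injˡ m-large =
  let i , fresh-i , few-fixed = i-choice
      j , not-bad             = count<k⇒∃¬ (Bad? i) (few-bad i few-fixed)
  in  i , j , fresh-i , not-bad ∘ inj₁ , not-bad ∘ inj₂ ∘ inj₁ , not-bad ∘ inj₂ ∘ inj₂ ∘ inj₁
        , not-bad ∘ inj₂ ∘ inj₂ ∘ inj₂ ∘ inj₁ , not-bad ∘ inj₂ ∘ inj₂ ∘ inj₂ ∘ inj₂
  where
  open ≤-Reasoning
  s = count O?

  Fixed? : ∀ i → Decidable (λ j → X i j ≡ j)
  Fixed? i j = X i j ≟ j

  Hits? : ∀ i → Decidable (λ j → X i j ≡ i)
  Hits? i j = X i j ≟ i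

  Bad? : ∀ i → Decidable (λ j → Image O σ j ⊎ Image O σ (X i j) ⊎ i ≡ j ⊎ X i j ≡ i ⊎ X i j ≡ j)
  Bad? i = Image? O? σ ∪? Image? O? σ ∘ X i ∪? (i ≟_) ∪? Hits? i ∪? Fixed? i

  few-bad : ∀ i → count (Fixed? i) < 2 → count (Bad? i) < m
  few-bad i few-fixed = begin-strict
    count (Bad? i)
      ≤⟨ count-∪ (Image? O? σ) (Image? O? σ ∘ X i ∪? (i ≟_) ∪? Hits? i ∪? Fixed? i)
           (count-Image∘inj O? σ id)
         (count-∪ (Image? O? σ ∘ X i) ((i ≟_) ∪? Hits? i ∪? Fixed? i)
           (count-Image∘inj O? σ (X-injʳ i))
         (count-∪ (i ≟_) (Hits? i ∪? Fixed? i)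
           (count-≤1 (i ≟_) λ _ _ e e′ → ≡.trans (≡.sym e) e′)
         (count-∪ (Hits? i) (Fixed? i)
           (count-≤1 (Hits? i) λ _ _ e e′ → X-injʳ i (≡.trans e (≡.sym e′)))
           (s≤s⁻¹ few-fixed)))) ⟩
    s + (s + (1 + (1 + 1)))  <⟨ Arith.s+[s+3]<m {s = s} m-large ⟩
    m                        ∎

  many-fresh : m ≤ s + count (∁? (Image? O? σ))
  many-fresh = begin
    m
      ≡⟨ ≡.sym (count-universal (Image? O? σ ∪? ∁? (Image? O? σ)) (toSum ∘ Image? O? σ)) ⟩
    count (Image? O? σ ∪? ∁? (Image? O? σ))
      ≤⟨ count-∪ (Image? O? σ) (∁? (Image? O? σ)) (count-Image∘inj O? σ id) ≤-refl ⟩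
    s + count (∁? (Image? O? σ)) ∎

  i-choice : ∃ λ i → Fresh O σ i × count (Fixed? i) < 2
  i-choice = ∃-below-average (∁? (Image? O? σ)) (λ i → count (Fixed? i)) 2
    (≤-<-trans (∑-count-≤ Fixed? λ j _ _ e e′ → X-injˡ j (≡.trans e (≡.sym e′)))
               (Arith.m<g*2 {s = s} many-fresh (<-≤-trans (m<m+n (2 * s) z<s) m-large)))

module _ {n k} (f : Fin (3 + k) → Fin n) (f-inj : ∀ i j → f i ≡ f j → i ≡ j) where

  private
    f≢ : ∀ {i j} → i ≢ j → f i ≢ f j
    f≢ i≢j = i≢j ∘ f-inj _ _

  two-others : ∀ x → ∃₂ λ i j → x ≢ f i × x ≢ f j × f i ≢ f j
  two-others x with x ≟ f 0F | x ≟ f 1F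
  ... | yes ≡.refl | _          = 1F , 2F , f≢ (λ ()) , f≢ (λ ()) , f≢ (λ ())
  ... | no x≢f₀    | yes ≡.refl = 0F , 2F , x≢f₀ , f≢ (λ ()) , f≢ (λ ())
  ... | no x≢f₀    | no x≢f₁    = 0F , 1F , x≢f₀ , x≢f₁ , f≢ (λ ())

module _ {c ℓ} (Γ : AbelianGroup c ℓ) where
  open AbelianGroup Γ
  open import Algebra.Properties.AbelianGroup Γ
    using (ε⁻¹≈ε; ⁻¹-involutive; ⁻¹-∙-comm; ⁻¹-injective; ∙-cancelˡ; ∙-cancelʳ; xyx⁻¹≈y)
  open import Algebra.Properties.CommutativeMonoid.Sum commutativeMonoid
    using (sum-cong-≋; sum-cong-≗; sum-replicate-zero; sum-remove)
    renaming (sum to ∑; ∑-distrib-+ to ∑-distrib-∙)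
  open import Algebra.Solver.CommutativeMonoid commutativeMonoid using (solve; _⊜_; _⊕_)
  open import Relation.Binary.Reasoning.Setoid setoid

  x-ε≈x : ∀ a → a - ε ≈ a
  x-ε≈x a = trans (∙-congˡ ε⁻¹≈ε) (identityʳ a)

  x∙[y-x]≈y : ∀ p a → p ∙ (a - p) ≈ a
  x∙[y-x]≈y p a = trans (sym (assoc p a (p ⁻¹))) (xyx⁻¹≈y p a)

  x⁻¹-y⁻¹≈y-x : ∀ a b → a ⁻¹ - b ⁻¹ ≈ b - a
  x⁻¹-y⁻¹≈y-x a b = trans (∙-congˡ (⁻¹-involutive b)) (comm (a ⁻¹) b)

  ∙-−-interchange : ∀ a b c d → (a ∙ b) - (c ∙ d) ≈ (a - c) ∙ (b - d)
  ∙-−-interchange a b c d = begin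
    (a ∙ b) ∙ (c ∙ d) ⁻¹     ≈⟨ ∙-congˡ (sym (⁻¹-∙-comm c d)) ⟩
    (a ∙ b) ∙ (c ⁻¹ ∙ d ⁻¹)  ≈⟨ solve 4 (λ a b c d → (a ⊕ b) ⊕ (c ⊕ d) ⊜ (a ⊕ c) ⊕ (b ⊕ d))
                                       refl a b (c ⁻¹) (d ⁻¹) ⟩
    (a - c) ∙ (b - d)        ∎

  −-telescope : ∀ p a b c → (p ∙ (b - a)) ∙ (c - b) ≈ p ∙ (c - a)
  −-telescope p a b c = begin
    (p ∙ (b - a)) ∙ (c - b)  ≈⟨ solve 5 (λ p a b c b′ → (p ⊕ (b ⊕ a)) ⊕ (c ⊕ b′)
                                                     ⊜ (p ⊕ (c ⊕ a)) ⊕ (b ⊕ b′))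
                                       refl p (a ⁻¹) b c (b ⁻¹) ⟩
    (p ∙ (c - a)) ∙ (b - b)  ≈⟨ ∙-congˡ (inverseʳ b) ⟩
    (p ∙ (c - a)) ∙ ε        ≈⟨ identityʳ _ ⟩
    p ∙ (c - a)              ∎

  subtracted-injective : ∀ p a a′ w → p ∙ (ε - (a - w)) ≈ p ∙ (ε - (a′ - w)) → a ≈ a′
  subtracted-injective p a a′ w eq =
    ∙-cancelʳ (w ⁻¹) a a′ (⁻¹-injective (∙-cancelˡ ε _ _ (∙-cancelˡ p _ _ eq)))

  ΣFin≡∑ : ∀ k (f : Fin k → Carrier) → ΣFin Γ k f ≡ ∑ f
  ΣFin≡∑ zero    f = ≡.refl
  ΣFin≡∑ (suc k) f = ≡.cong (f zero ∙_) (ΣFin≡∑ k (f ∘ suc))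

  δ : ∀ {k} → Fin k → Carrier → Fin k → Carrier
  δ a g v = if does (v ≟ a) then g else ε

  δ-self : ∀ {k} (a : Fin k) g → δ a g a ≡ g
  δ-self a g rewrite dec-true (a ≟ a) ≡.refl = ≡.refl

  δ-other : ∀ {k} {a v : Fin k} g → v ≢ a → δ a g v ≡ ε
  δ-other {a = a} {v} g v≢a rewrite dec-false (v ≟ a) v≢a = ≡.refl

  δ-⁻¹ : ∀ {k} (a v : Fin k) g → δ a (g ⁻¹) v ≈ δ a g v ⁻¹
  δ-⁻¹ a v g with does (v ≟ a)
  ... | true  = refl
  ... | false = sym ε⁻¹≈ε

  ∑-δ : ∀ {k} (a : Fin k) g → ∑ (δ a g) ≈ g
  ∑-δ {suc k} a g = begin
    ∑ (δ a g)                        ≈⟨ sum-remove {i = a} (δ a g) ⟩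
    δ a g a ∙ ∑ (δ a g ∘ punchIn a)  ≈⟨ ∙-cong (reflexive (δ-self a g)) zero-elsewhere ⟩
    g ∙ ε                            ≈⟨ identityʳ g ⟩
    g                                ∎
    where
    zero-elsewhere : ∑ (δ a g ∘ punchIn a) ≈ ε
    zero-elsewhere = trans (sum-cong-≋ (λ j → reflexive (δ-other g (punchInᵢ≢i a j))))
                           (sum-replicate-zero k)

  module _ {n} (G : Digraph n) where

    Lab : Set c
    Lab = Labeling G Carrier

    _+ᴸ_ : Lab → Lab → Lab
    (ψ₁ +ᴸ ψ₂) x y e = ψ₁ x y e ∙ ψ₂ x y e

    inflow outflow : Lab → Fin n → Carrier
    inflow  ψ x = ∑ (λ y → ifArc Γ (arc G y x) (ψ y x))
    outflow ψ x = ∑ (λ y → ifArc Γ (arc G x y) (ψ x y))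

    φ≡inflow-outflow : ∀ ψ x → φ Γ G ψ x ≡ inflow ψ x - outflow ψ x
    φ≡inflow-outflow ψ x = ≡.cong₂ _-_ (ΣFin≡∑ n _) (ΣFin≡∑ n _)

    ifArc-∙ : ∀ b (f h : b ≡ true → Carrier) →
              ifArc Γ b (λ e → f e ∙ h e) ≈ ifArc Γ b f ∙ ifArc Γ b h
    ifArc-∙ true  f h = refl
    ifArc-∙ false f h = sym (identityˡ ε)

    ∑-ifArc-∙ : ∀ (b : Fin n → Bool) (f h : ∀ y → b y ≡ true → Carrier) →
                ∑ (λ y → ifArc Γ (b y) (λ e → f y e ∙ h y e))
                  ≈ ∑ (λ y → ifArc Γ (b y) (f y)) ∙ ∑ (λ y → ifArc Γ (b y) (h y))
    ∑-ifArc-∙ b f h = trans (sum-cong-≋ (λ y → ifArc-∙ (b y) (f y) (h y)))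
                            (∑-distrib-∙ (λ y → ifArc Γ (b y) (f y)) (λ y → ifArc Γ (b y) (h y)))

    φ-+ᴸ : ∀ ψ₁ ψ₂ x → φ Γ G (ψ₁ +ᴸ ψ₂) x ≈ φ Γ G ψ₁ x ∙ φ Γ G ψ₂ x
    φ-+ᴸ ψ₁ ψ₂ x = begin
      φ Γ G (ψ₁ +ᴸ ψ₂) x
        ≡⟨ φ≡inflow-outflow (ψ₁ +ᴸ ψ₂) x ⟩
      inflow (ψ₁ +ᴸ ψ₂) x - outflow (ψ₁ +ᴸ ψ₂) x
        ≈⟨ ∙-cong (∑-ifArc-∙ (λ y → arc G y x) (λ y → ψ₁ y x) (λ y → ψ₂ y x))
                  (⁻¹-cong (∑-ifArc-∙ (arc G x) (ψ₁ x) (ψ₂ x))) ⟩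
      (inflow ψ₁ x ∙ inflow ψ₂ x) - (outflow ψ₁ x ∙ outflow ψ₂ x)
        ≈⟨ ∙-−-interchange _ _ _ _ ⟩
      (inflow ψ₁ x - outflow ψ₁ x) ∙ (inflow ψ₂ x - outflow ψ₂ x)
        ≡⟨ ≡.sym (≡.cong₂ _∙_ (φ≡inflow-outflow ψ₁ x) (φ≡inflow-outflow ψ₂ x)) ⟩
      φ Γ G ψ₁ x ∙ φ Γ G ψ₂ x ∎

    arcLabel : Fin n → Fin n → Carrier → Lab
    arcLabel a b g u w _ = δ a (δ b g w) u

    module _ {a b} (ab : arc G a b ≡ true) (g : Carrier) where

      ifArc-arcLabel : ∀ u w → ifArc Γ (arc G u w) (arcLabel a b g u w) ≡ δ a (δ b g w) u
      ifArc-arcLabel u w with arc G u w in uw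
      ... | true  = ≡.refl
      ... | false with u ≟ a | w ≟ b
      ...   | yes ≡.refl | yes ≡.refl = contradiction (≡.trans (≡.sym ab) uw) λ ()
      ...   | yes _      | no _       = ≡.refl
      ...   | no _       | _          = ≡.refl

      φ-arcLabel : ∀ v → φ Γ G (arcLabel a b g) v ≈ δ b g v - δ a g v
      φ-arcLabel v = begin
        φ Γ G (arcLabel a b g) v
          ≡⟨ φ≡inflow-outflow (arcLabel a b g) v ⟩
        inflow (arcLabel a b g) v - outflow (arcLabel a b g) v
          ≡⟨ ≡.cong₂ _-_ (sum-cong-≗ (λ u → ifArc-arcLabel u v)) (sum-cong-≗ (ifArc-arcLabel v)) ⟩
        ∑ (δ a (δ b g v)) - ∑ (λ w → δ a (δ b g w) v)
          ≈⟨ ∙-cong (∑-δ a (δ b g v)) (⁻¹-cong out) ⟩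
        δ b g v - δ a g v ∎
        where
        out : ∑ (λ w → δ a (δ b g w) v) ≈ δ a g v
        out with does (v ≟ a)
        ... | true  = ∑-δ b g
        ... | false = sum-replicate-zero n

    arcTransfer : ∀ {y z} → Adj G y z → Carrier → Lab
    arcTransfer {y} {z} (inj₁ _) g = arcLabel y z g
    arcTransfer {y} {z} (inj₂ _) g = arcLabel z y (g ⁻¹)

    φ-arcTransfer : ∀ {y z} (adj : Adj G y z) g v →
                    φ Γ G (arcTransfer adj g) v ≈ δ z g v - δ y g v
    φ-arcTransfer (inj₁ yz) g v = φ-arcLabel yz g v
    φ-arcTransfer {y} {z} (inj₂ zy) g v = begin
      φ Γ G (arcLabel z y (g ⁻¹)) v  ≈⟨ φ-arcLabel zy (g ⁻¹) v ⟩
      δ y (g ⁻¹) v - δ z (g ⁻¹) v    ≈⟨ ∙-cong (δ-⁻¹ y v g) (⁻¹-cong (δ-⁻¹ z v g)) ⟩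
      δ y g v ⁻¹ - δ z g v ⁻¹        ≈⟨ x⁻¹-y⁻¹≈y-x (δ y g v) (δ z g v) ⟩
      δ z g v - δ y g v              ∎

    transfer : ∀ {a b} → Conn G a b → Carrier → Lab → Lab
    transfer here         g ψ = ψ
    transfer (step p adj) g ψ = transfer p g ψ +ᴸ arcTransfer adj g

    φ-transfer : ∀ {a b} (p : Conn G a b) g ψ v →
                 φ Γ G (transfer p g ψ) v ≈ φ Γ G ψ v ∙ (δ b g v - δ a g v)
    φ-transfer {a} here g ψ v = sym (trans (∙-congˡ (inverseʳ (δ a g v))) (identityʳ _))
    φ-transfer {a} (step {y} {z} p adj) g ψ v = begin
      φ Γ G (transfer p g ψ +ᴸ arcTransfer adj g) v
        ≈⟨ φ-+ᴸ (transfer p g ψ) (arcTransfer adj g) v ⟩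
      φ Γ G (transfer p g ψ) v ∙ φ Γ G (arcTransfer adj g) v
        ≈⟨ ∙-cong (φ-transfer p g ψ v) (φ-arcTransfer adj g v) ⟩
      (φ Γ G ψ v ∙ (δ y g v - δ a g v)) ∙ (δ z g v - δ y g v)
        ≈⟨ −-telescope _ _ _ _ ⟩
      φ Γ G ψ v ∙ (δ z g v - δ a g v) ∎

    Separated : Lab → Fin n → Set ℓ
    Separated ψ a = ∀ b → a ≢ b → ¬ (φ Γ G ψ a ≈ φ Γ G ψ b)

    separation-preserved : ∀ {p} {T : Pred (Fin n) p} (T? : Decidable T) {ψ ψ′} →
      (∀ v → ¬ T v → φ Γ G ψ′ v ≈ φ Γ G ψ v) → (∀ w → T w → Separated ψ′ w) →
      ∀ a → Separated ψ a → Separated ψ′ a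
    separation-preserved T? same sep′ a sep b a≢b eq with T? a | T? b
    ... | yes ta | _      = sep′ a ta b a≢b eq
    ... | no _   | yes tb = sep′ b tb a (a≢b ∘ ≡.sym) (sym eq)
    ... | no ¬ta | no ¬tb = sep b a≢b (trans (sym (same a ¬ta)) (trans eq (same b ¬tb)))

    separated⇒irregular : ∀ {ψ} → (∀ a → Separated ψ a) → IsIrregular Γ G ψ
    separated⇒irregular sep a b eq = decidable-stable (a ≟ b) (λ a≢b → sep a b a≢b eq)

    SeparatedBelow : Lab → ℕ → Set ℓ
    SeparatedBelow ψ k = ∀ a → toℕ a < k → Separated ψ a

    SeparatingExtension : Lab → Fin n → Set (c ⊔ ℓ)
    SeparatingExtension ψ x = ∃ λ ψ′ → (∀ a → Separated ψ a → Separated ψ′ a) × Separated ψ′ x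

    extend-below : ∀ {ψ k} (k<n : k < n) → SeparatedBelow ψ k →
                   SeparatingExtension ψ (fromℕ< k<n) → ∃ λ ψ′ → SeparatedBelow ψ′ (suc k)
    extend-below {k = k} k<n sep (ψ′ , preserved , sep-k) = ψ′ , below
      where
      below : SeparatedBelow ψ′ (suc k)
      below a a<1+k with m<1+n⇒m<n∨m≡n a<1+k
      ... | inj₁ a<k = preserved a (sep a a<k)
      ... | inj₂ a≡k =
        ≡.subst (Separated ψ′) (toℕ-injective (≡.trans (toℕ-fromℕ< k<n) (≡.sym a≡k))) sep-k

    module _ {m} (order : HasOrder Γ m) where

      enc : Fin m → Carrier
      enc = proj₁ order

      enc-injective : ∀ i j → enc i ≈ enc j → i ≡ j
      enc-injective = proj₁ (proj₂ order)

      code : Carrier → Fin m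
      code g = proj₁ (proj₂ (proj₂ order) g)

      enc-code : ∀ g → enc (code g) ≈ g
      enc-code g = proj₂ (proj₂ (proj₂ order) g)

      code-unique : ∀ {g t} → g ≈ enc t → code g ≡ t
      code-unique {g} g≈t = enc-injective _ _ (trans (enc-code g) g≈t)

      code-injective : ∀ {g h} → code g ≡ code h → g ≈ h
      code-injective {g} {h} e =
        trans (sym (enc-code g)) (trans (reflexive (≡.cong enc e)) (enc-code h))

      module _ (ψ : Lab) {x y z} (x≢y : x ≢ y) (x≢z : x ≢ z) (y≢z : y ≢ z)
               (x⇝y : Conn G x y) (x⇝z : Conn G x z) where

        Touched : Pred (Fin n) _
        Touched v = v ≡ x ⊎ v ≡ y ⊎ v ≡ z

        Touched? : Decidable Touched
        Touched? v = v ≟ x ⊎-dec v ≟ y ⊎-dec v ≟ z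

        old : Fin n → Fin m
        old v = code (φ Γ G ψ v)

        toY toZ : Fin m → Carrier
        toY i = enc i - φ Γ G ψ y
        toZ j = enc j - φ Γ G ψ z

        relabel : Fin m → Fin m → Lab
        relabel i j = transfer x⇝z (toZ j) (transfer x⇝y (toY i) ψ)

        φ-relabel : ∀ i j v {d₁ e₁ d₂ e₂} →
          δ y (toY i) v ≡ d₁ → δ x (toY i) v ≡ e₁ → δ z (toZ j) v ≡ d₂ → δ x (toZ j) v ≡ e₂ →
          φ Γ G (relabel i j) v ≈ (φ Γ G ψ v ∙ (d₁ - e₁)) ∙ (d₂ - e₂)
        φ-relabel i j v ≡.refl ≡.refl ≡.refl ≡.refl =
          trans (φ-transfer x⇝z (toZ j) _ v) (∙-congʳ (φ-transfer x⇝y (toY i) ψ v))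

        atX : Fin m → Fin m → Carrier
        atX i j = (φ Γ G ψ x ∙ (ε - toY i)) ∙ (ε - toZ j)

        X : Fin m → Fin m → Fin m
        X i j = code (atX i j)

        relabel-x : ∀ i j → φ Γ G (relabel i j) x ≈ atX i j
        relabel-x i j = φ-relabel i j x (δ-other (toY i) x≢y) (δ-self x (toY i))
                                        (δ-other (toZ j) x≢z) (δ-self x (toZ j))

        relabel-y : ∀ i j → φ Γ G (relabel i j) y ≈ enc i
        relabel-y i j = begin
          φ Γ G (relabel i j) y
            ≈⟨ φ-relabel i j y (δ-self y (toY i)) (δ-other (toY i) (x≢y ∘ ≡.sym))
                               (δ-other (toZ j) y≢z) (δ-other (toZ j) (x≢y ∘ ≡.sym)) ⟩
          (φ Γ G ψ y ∙ (toY i - ε)) ∙ (ε - ε)  ≈⟨ ∙-cong (∙-congˡ (x-ε≈x (toY i))) (x-ε≈x ε) ⟩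
          (φ Γ G ψ y ∙ toY i) ∙ ε              ≈⟨ identityʳ _ ⟩
          φ Γ G ψ y ∙ (enc i - φ Γ G ψ y)      ≈⟨ x∙[y-x]≈y (φ Γ G ψ y) (enc i) ⟩
          enc i                                ∎

        relabel-z : ∀ i j → φ Γ G (relabel i j) z ≈ enc j
        relabel-z i j = begin
          φ Γ G (relabel i j) z
            ≈⟨ φ-relabel i j z (δ-other (toY i) (y≢z ∘ ≡.sym)) (δ-other (toY i) (x≢z ∘ ≡.sym))
                               (δ-self z (toZ j)) (δ-other (toZ j) (x≢z ∘ ≡.sym)) ⟩
          (φ Γ G ψ z ∙ (ε - ε)) ∙ (toZ j - ε)  ≈⟨ ∙-cong (∙-congˡ (x-ε≈x ε)) (x-ε≈x (toZ j)) ⟩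
          (φ Γ G ψ z ∙ ε) ∙ toZ j              ≈⟨ ∙-congʳ (identityʳ _) ⟩
          φ Γ G ψ z ∙ (enc j - φ Γ G ψ z)      ≈⟨ x∙[y-x]≈y (φ Γ G ψ z) (enc j) ⟩
          enc j                                ∎

        relabel-untouched : ∀ i j v → ¬ Touched v → φ Γ G (relabel i j) v ≈ φ Γ G ψ v
        relabel-untouched i j v ¬t = begin
          φ Γ G (relabel i j) v
            ≈⟨ φ-relabel i j v (δ-other (toY i) (¬t ∘ inj₂ ∘ inj₁)) (δ-other (toY i) (¬t ∘ inj₁))
                               (δ-other (toZ j) (¬t ∘ inj₂ ∘ inj₂)) (δ-other (toZ j) (¬t ∘ inj₁)) ⟩
          (φ Γ G ψ v ∙ (ε - ε)) ∙ (ε - ε)  ≈⟨ ∙-cong (∙-congˡ (x-ε≈x ε)) (x-ε≈x ε) ⟩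
          (φ Γ G ψ v ∙ ε) ∙ ε              ≈⟨ trans (identityʳ _) (identityʳ _) ⟩
          φ Γ G ψ v                        ∎

        X-injʳ : ∀ i → Injective _≡_ _≡_ (X i)
        X-injʳ i {j} {j′} e = enc-injective j j′
          (subtracted-injective (φ Γ G ψ x ∙ (ε - toY i)) _ _ _ (code-injective e))

        X-injˡ : ∀ j → Injective _≡_ _≡_ (λ i → X i j)
        X-injˡ j {i} {i′} e = enc-injective i i′
          (subtracted-injective (φ Γ G ψ x) _ _ _ (∙-cancelʳ (ε - toZ j) _ _ (code-injective e)))

        few-untouched : 2 * n ≤ m → 2 * count (∁? Touched?) + 4 ≤ m
        few-untouched =
          Arith.2s+4≤m (2+count∁≤ Touched? (inj₁ ≡.refl) (inj₂ (inj₁ ≡.refl)) x≢y)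

        module _ {i j} (fresh-i : Fresh (∁ Touched) old i) (fresh-j : Fresh (∁ Touched) old j)
                 (fresh-X : Fresh (∁ Touched) old (X i j))
                 (i≢j : i ≢ j) (X≢i : X i j ≢ i) (X≢j : X i j ≢ j) where

          new : ∀ {w} → Touched w → Fin m
          new (inj₁ _)        = X i j
          new (inj₂ (inj₁ _)) = i
          new (inj₂ (inj₂ _)) = j

          φ-new : ∀ {w} (t : Touched w) → φ Γ G (relabel i j) w ≈ enc (new t)
          φ-new (inj₁ ≡.refl)        = trans (relabel-x i j) (sym (enc-code (atX i j)))
          φ-new (inj₂ (inj₁ ≡.refl)) = relabel-y i j
          φ-new (inj₂ (inj₂ ≡.refl)) = relabel-z i j

          new-fresh : ∀ {w} (t : Touched w) → Fresh (∁ Touched) old (new t)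
          new-fresh (inj₁ _)        = fresh-X
          new-fresh (inj₂ (inj₁ _)) = fresh-i
          new-fresh (inj₂ (inj₂ _)) = fresh-j

          new-injective : ∀ {w w′} (t : Touched w) (t′ : Touched w′) → new t ≡ new t′ → w ≡ w′
          new-injective (inj₁ ≡.refl)        (inj₁ ≡.refl)        _ = ≡.refl
          new-injective (inj₁ _)             (inj₂ (inj₁ _))      e = contradiction e X≢i
          new-injective (inj₁ _)             (inj₂ (inj₂ _))      e = contradiction e X≢j
          new-injective (inj₂ (inj₁ _))      (inj₁ _)             e = contradiction (≡.sym e) X≢i
          new-injective (inj₂ (inj₁ ≡.refl)) (inj₂ (inj₁ ≡.refl)) _ = ≡.refl
          new-injective (inj₂ (inj₁ _))      (inj₂ (inj₂ _))      e = contradiction e i≢j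
          new-injective (inj₂ (inj₂ _))      (inj₁ _)             e = contradiction (≡.sym e) X≢j
          new-injective (inj₂ (inj₂ _))      (inj₂ (inj₁ _))      e = contradiction (≡.sym e) i≢j
          new-injective (inj₂ (inj₂ ≡.refl)) (inj₂ (inj₂ ≡.refl)) _ = ≡.refl

          touched-separated : ∀ w → Touched w → Separated (relabel i j) w
          touched-separated w t b w≢b eq with Touched? b
          ... | yes t′ = w≢b (new-injective t t′
                               (enc-injective _ _ (trans (sym (φ-new t)) (trans eq (φ-new t′)))))
          ... | no ¬t′ = new-fresh t (b , ¬t′ , code-unique
                           (trans (sym (relabel-untouched i j b ¬t′)) (trans (sym eq) (φ-new t))))

        separate-vertex : 2 * n ≤ m → SeparatingExtension ψ x
        separate-vertex 2n≤m =
          from-fresh (fresh-triple (∁? Touched?) old X X-injʳ X-injˡ (few-untouched 2n≤m))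
          where
          from-fresh : FreshTriple (∁ Touched) old X → SeparatingExtension ψ x
          from-fresh (i , j , fresh-i , fresh-j , fresh-X , i≢j , X≢i , X≢j) =
            relabel i j , separation-preserved Touched? (relabel-untouched i j) sep , sep x (inj₁ ≡.refl)
            where
            sep : ∀ w → Touched w → Separated (relabel i j) w
            sep = touched-separated fresh-i fresh-j fresh-X i≢j X≢i X≢j

      separate-below : NoSmallComponents G → 2 * n ≤ m → ∀ k → k ≤ n → ∃ λ ψ → SeparatedBelow ψ k
      separate-below nsc 2n≤m zero    _   = (λ _ _ _ → ε) , λ _ ()
      separate-below nsc 2n≤m (suc k) k<n
        with separate-below nsc 2n≤m k (<⇒≤ k<n) | nsc (fromℕ< k<n)
      ... | ψ , sep | f , f-inj , x⇝f with two-others f f-inj (fromℕ< k<n)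
      ... | i , j , x≢fi , x≢fj , fi≢fj =
        extend-below k<n sep (separate-vertex ψ x≢fi x≢fj fi≢fj (x⇝f i) (x⇝f j) 2n≤m)

corollary4p5 : ∀ {c ℓ} (n : ℕ) (G : Digraph n) → NoSmallComponents G →
    (Γ : AbelianGroup c ℓ) (m : ℕ) → HasOrder Γ m → 2 * n + 1 ≤ m →
    Σ (Labeling G (AbelianGroup.Carrier Γ)) (λ ψ → IsIrregular Γ G ψ)
corollary4p5 n G nsc Γ m order 2n+1≤m =
  map₂ (λ sep → separated⇒irregular Γ G (λ a → sep a (toℕ<n a)))
       (separate-below Γ G order nsc (≤-trans (m≤m+n (2 * n) 1) 2n+1≤m) n ≤-refl)
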